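{- For every $g:\{0,1\}^k\times\{0,1\}^k\to\{0,1\}$ the following hold. (1) If for some $b\in\{0,1\}$ there is a $\left(\frac{1}{20},h\right)$-hitting distribution over $b$-monochromatic rectangles of $g$, then there is a $\left(\frac{1}{10},h\right)$-hitting distribution over $b$-monochromatic rectangles of $g$ whose support has size $2^{O(k)}$ (i.e., at most $2^{Ck}$ for an absolute constant $C$ independent of $g,k,h,b$). (2) If for some $\delta<1$ and positive integer $h$ there are two $(\delta,h)$-hitting distributions $\mu_0,\mu_1$, where $\mu_b$ is over $b$-monochromatic rectangles of $g$, then for every $b\in\{0,1\}$ the support of $\mu_b$ has size at least $2^h$.
   Context: A rectangle is a set $U\times V$ with $U,V\subseteq\{0,1\}^k$; it is $b$-monochromatic for $g$ if $g\equiv b$ on it. A probability distribution $\mu$ over rectangles is $(\delta,h)$-hitting if for all $X,Y\subseteq\{0,1\}^k$ with $|X|\ge 2^{k-h}$ and $|Y|\ge 2^{k-h}$ we have $\Pr_{R\sim\mu}[R\cap(X\times Y)\ne\varnothing]\ge 1-\delta$.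
   Formalization: The probability distributions over rectangles have rational weights, and the parameter δ in part (2) is rational. -}

module Defs where

open import Data.Bool using (Bool; true; false; _∧_; if_then_else_)
open import Data.Nat using (ℕ; zero; suc; _^_; _∸_; _*_) renaming (_≤_ to _≤ℕ_)
open import Data.Integer using (+_)
open import Data.Rational using (ℚ; 0ℚ; 1ℚ; _+_; _-_; _≤_; _<_; _/_)
open import Data.Vec using (Vec; []; _∷_)
open import Data.List using (List; []; _∷_; _++_; map; filter; length; foldr)
open import Data.Bool.ListAction using (any)
open import Data.List.Relation.Unary.All using (All)
open import Data.List.Relation.Unary.AllPairs using (AllPairs)
open import Data.Product using (_×_; _,_; proj₁; proj₂)
open import Data.Sum using (_⊎_)
open import Relation.Binary.PropositionalEquality using (_≡_)
open import Relation.Nullary using (¬_)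

Point : ℕ → Set
Point k = Vec Bool k

allPoints : (k : ℕ) → List (Point k)
allPoints zero = [] ∷ []
allPoints (suc k) = map (true ∷_) (allPoints k) ++ map (false ∷_) (allPoints k)

Subset : ℕ → Set
Subset k = Point k → Bool

card : {k : ℕ} → Subset k → ℕ
card {k} X = length (filter (λ x → X x ≡? true) (allPoints k))
  where
  open import Data.Bool.Properties using () renaming (_≟_ to _≡?_)

Fn : ℕ → Set
Fn k = Point k → Point k → Bool

Rect : ℕ → Set
Rect k = Subset k × Subset k

Monochromatic : {k : ℕ} → Fn k → Bool → Rect k → Set
Monochromatic g b (U , V) = ∀ x y → U x ≡ true → V y ≡ true → g x y ≡ b

SameRect : {k : ℕ} → Rect k → Rect k → Set
SameRect (U , V) (U' , V') = (∀ x → U x ≡ U' x) × (∀ y → V y ≡ V' y)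

-- A finitely supported probability distribution over rectangles with rational
-- weights: a list of (rectangle, weight) pairs, the rectangles pairwise
-- distinct, every weight strictly positive, weights summing to 1.
-- Its support is exactly the set of listed rectangles.
Dist : ℕ → Set
Dist k = List (Rect k × ℚ)

totalWeight : {k : ℕ} → Dist k → ℚ
totalWeight = foldr (λ p s → proj₂ p + s) 0ℚ

IsDistribution : {k : ℕ} → Dist k → Set
IsDistribution μ =
  All (λ p → 0ℚ < proj₂ p) μ
  × AllPairs (λ p q → ¬ SameRect (proj₁ p) (proj₁ q)) μ
  × totalWeight μ ≡ 1ℚ

supportSize : {k : ℕ} → Dist k → ℕ
supportSize = length

OverMono : {k : ℕ} → Fn k → Bool → Dist k → Set
OverMono g b μ = All (λ p → Monochromatic g b (proj₁ p)) μ

meets : {k : ℕ} → Rect k → Subset k → Subset k → Bool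
meets {k} (U , V) X Y =
  any (λ x → U x ∧ X x) (allPoints k) ∧ any (λ y → V y ∧ Y y) (allPoints k)

hitProb : {k : ℕ} → Dist k → Subset k → Subset k → ℚ
hitProb μ X Y = foldr (λ p s → (if meets (proj₁ p) X Y then proj₂ p else 0ℚ) + s) 0ℚ μ

-- (δ,h)-hitting; note 2^(k ∸ h) with truncated subtraction is the correct
-- integer threshold: for h ≥ k, |X| ≥ 2^(k-h) ≤ 1 means X nonempty.
Hitting : {k : ℕ} → ℚ → ℕ → Dist k → Set
Hitting {k} δ h μ =
  ∀ (X Y : Subset k) → 2 ^ (k ∸ h) ≤ℕ card X → 2 ^ (k ∸ h) ≤ℕ card Y →
  1ℚ - δ ≤ hitProb μ X Y

HittingMonoDist : {k : ℕ} → Fn k → Bool → ℚ → ℕ → Dist k → Set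
HittingMonoDist g b δ h μ = IsDistribution μ × OverMono g b μ × Hitting δ h μ

-- (2) A b-monochromatic rectangle U × V cannot have both sides of size at least
-- 2^(k-h): a hitting distribution over (not b)-monochromatic rectangles would meet
-- it, giving a point of both colours.  So every rectangle in the support of μ_b has
-- a side with fewer than 2^(k-h) points.  Removing these small sides from {0,1}^k
-- leaves sets X and Y which, if the support had fewer than 2^h rectangles, would
-- still have at least 2^k - (2^h - 1)(2^(k-h) - 1) ≥ 2^(k-h) points, and μ_b would
-- miss X × Y altogether.
--
-- (1) Up to extensional equality there are at most 2^(2^(k+1)) pairs (X, Y) to hit.
-- Draw t = 40·2^(k+1) rectangles from the support by the method of conditional
-- expectations, with pessimistic estimator Φ(s) = Σ_(X,Y) 2^(number of rectangles of
-- s missing X × Y).  Each pair is hit with probability at least 19/20, so a further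
-- draw multiplies Φ by at most 21/20 in expectation and hence, for some rectangle
-- of the support, in fact.  After t steps every pair is missed fewer than t/10
-- times, because 2^(2^(k+1)) (21/20)^t < 2^(t/10); the uniform distribution on the
-- sample is therefore (1/10, h)-hitting with support at most t ≤ 2^(8k) when
-- k ≥ 1.  For k = 0, a single rectangle meeting the one-point square suffices.

module Submission where

open import Defs
open import Data.Bool using (Bool; false; true; not; _∧_; if_then_else_)
open import Data.Bool.ListAction using (any; all; or)
open import Data.Bool.Properties using (∧-zeroʳ; not-¬) renaming (_≟_ to _≟ᵇ_)
open import Data.List using (List; []; _∷_; _++_; map; filter; foldr; length; cartesianProductWith; cartesianProduct)
open import Data.List.Membership.Propositional using (_∈_; find)
open import Data.List.Membership.Propositional.Properties using (∈-map⁺; ∈-++⁺ˡ; ∈-++⁺ʳ; ∈-filter⁺; ∈-cartesianProductWith⁺)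
import Data.List.Properties as List
open import Data.List.Relation.Unary.All as All using (All; []; _∷_)
open import Data.List.Relation.Unary.All.Properties using (map⁺; ¬Any⇒All¬; all-filter)
open import Data.List.Relation.Unary.AllPairs using (AllPairs; []; _∷_)
open import Data.List.Relation.Unary.Any using (Any; here; there; any?)
open import Data.Nat using (ℕ; zero; suc; NonZero; _+_; _*_; _^_; _∸_; _≤?_; z≤n; s≤s) renaming (_≤_ to _≤ℕ_; _<_ to _<ℕ_)
open import Data.Nat.ListAction using (sum)
import Data.Nat.Properties as ℕ
open import Algebra.Properties.CommutativeSemigroup ℕ.*-commutativeSemigroup using (interchange; x∙yz≈y∙xz)
open import Data.Product using (Σ; _×_; _,_; proj₁; proj₂; map₂)
open import Data.Rational using (ℚ; 0ℚ; 1ℚ; _/_; _≤_; _<_; -_; 1/_; Positive; positive; nonNegative) renaming (NonZero to NonZeroℚ; _+_ to _+ℚ_; _-_ to _-ℚ_; _*_ to _*ℚ_)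
open import Data.Rational.Solver using (module +-*-Solver)
import Data.Rational.Properties as ℚ
open import Data.Integer using (+_)
open import Data.Sum using (inj₁; inj₂)
open import Data.Empty using (⊥; ⊥-elim)
open import Data.Vec using ([]; _∷_)
open import Function using (_∘_)
open import Relation.Nullary using (¬_; Dec; yes; no)
open import Relation.Nullary.Decidable using (_×-dec_; toWitness)
open import Relation.Binary.PropositionalEquality using (_≡_; _≗_; refl; sym; trans; cong; cong₂; subst; subst₂; module ≡-Reasoning)

open +-*-Solver using (solve; _:+_; _:*_; _:-_; _:=_; con)

∧≡true⇒ : ∀ {a b} → a ∧ b ≡ true → a ≡ true × b ≡ true
∧≡true⇒ {true} {true} refl = refl , refl

countᵇ : {A : Set} → (A → Bool) → List A → ℕ
countᵇ p [] = 0
countᵇ p (x ∷ xs) = if p x then suc (countᵇ p xs) else countᵇ p xs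

module _ {A : Set} where

  countᵇ-cong : {p q : A → Bool} → p ≗ q → ∀ xs → countᵇ p xs ≡ countᵇ q xs
  countᵇ-cong p≗q [] = refl
  countᵇ-cong {p} {q} p≗q (x ∷ xs) rewrite p≗q x =
    cong (λ c → if q x then suc c else c) (countᵇ-cong p≗q xs)

  countᵇ-false : ∀ xs → countᵇ {A} (λ _ → false) xs ≡ 0
  countᵇ-false [] = refl
  countᵇ-false (x ∷ xs) = countᵇ-false xs

  countᵇ-true : ∀ xs → countᵇ {A} (λ _ → true) xs ≡ length xs
  countᵇ-true [] = refl
  countᵇ-true (x ∷ xs) = cong suc (countᵇ-true xs)

  countᵇ≤countᵇ[∁p∧q]+countᵇ[p] : (p q : A → Bool) → ∀ xs →
    countᵇ q xs ≤ℕ countᵇ (λ x → not (p x) ∧ q x) xs + countᵇ p xs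
  countᵇ≤countᵇ[∁p∧q]+countᵇ[p] p q [] = z≤n
  countᵇ≤countᵇ[∁p∧q]+countᵇ[p] p q (x ∷ xs) with p x | q x
  ... | false | true = s≤s (countᵇ≤countᵇ[∁p∧q]+countᵇ[p] p q xs)
  ... | false | false = countᵇ≤countᵇ[∁p∧q]+countᵇ[p] p q xs
  ... | true | true = ℕ.≤-trans (s≤s (countᵇ≤countᵇ[∁p∧q]+countᵇ[p] p q xs)) (ℕ.≤-reflexive (sym (ℕ.+-suc _ _)))
  ... | true | false = ℕ.≤-trans (countᵇ≤countᵇ[∁p∧q]+countᵇ[p] p q xs) (ℕ.+-monoʳ-≤ _ (ℕ.n≤1+n _))

  countᵇ+countᵇ-not : (p : A → Bool) → ∀ xs → countᵇ p xs + countᵇ (not ∘ p) xs ≡ length xs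
  countᵇ+countᵇ-not p [] = refl
  countᵇ+countᵇ-not p (x ∷ xs) with p x
  ... | true = cong suc (countᵇ+countᵇ-not p xs)
  ... | false = trans (ℕ.+-suc _ _) (cong suc (countᵇ+countᵇ-not p xs))

  any≡true⇒ : (p : A → Bool) → ∀ xs → any p xs ≡ true → Σ A λ x → p x ≡ true
  any≡true⇒ p (x ∷ xs) eq with p x in px
  ... | true = x , px
  ... | false = any≡true⇒ p xs eq

  any≡false : (p : A → Bool) → (∀ x → p x ≡ false) → ∀ xs → any p xs ≡ false
  any≡false p never [] = refl
  any≡false p never (x ∷ xs) rewrite never x = any≡false p never xs

  any-disjoint : (U X : A → Bool) → (∀ x → U x ≡ true → X x ≡ false) → ∀ xs → any (λ x → U x ∧ X x) xs ≡ false
  any-disjoint U X U∩X≡∅ = any≡false _ disjoint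
    where
    disjoint : ∀ x → U x ∧ X x ≡ false
    disjoint x with U x in Ux
    ... | false = refl
    ... | true = U∩X≡∅ x Ux

  any-cong : {p q : A → Bool} → p ≗ q → ∀ xs → any p xs ≡ any q xs
  any-cong p≗q xs = cong or (List.map-cong p≗q xs)

  outside : List (A → Bool) → A → Bool
  outside Ds x = all (λ D → not (D x)) Ds

  outside-∉ : ∀ {D Ds x} → D ∈ Ds → D x ≡ true → outside Ds x ≡ false
  outside-∉ (here refl) Dx rewrite Dx = refl
  outside-∉ {x = x} (there {x = E} D∈Ds) Dx =
    trans (cong (not (E x) ∧_) (outside-∉ D∈Ds Dx)) (∧-zeroʳ _)

  length≤countᵇ-outside+length*c : ∀ (xs : List A) c Ds → All (λ D → countᵇ D xs ≤ℕ c) Ds →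
    length xs ≤ℕ countᵇ (outside Ds) xs + length Ds * c
  length≤countᵇ-outside+length*c xs c [] [] =
    ℕ.≤-trans (ℕ.≤-reflexive (sym (countᵇ-true xs))) (ℕ.m≤m+n _ 0)
  length≤countᵇ-outside+length*c xs c (D ∷ Ds) (D≤c ∷ Ds≤c) = begin
    length xs                                                ≤⟨ length≤countᵇ-outside+length*c xs c Ds Ds≤c ⟩
    countᵇ (outside Ds) xs + length Ds * c                   ≤⟨ ℕ.+-monoˡ-≤ _ (countᵇ≤countᵇ[∁p∧q]+countᵇ[p] D (outside Ds) xs) ⟩
    (countᵇ (outside (D ∷ Ds)) xs + countᵇ D xs) + length Ds * c ≤⟨ ℕ.+-monoˡ-≤ (length Ds * c) (ℕ.+-monoʳ-≤ (countᵇ (outside (D ∷ Ds)) xs) D≤c) ⟩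
    (countᵇ (outside (D ∷ Ds)) xs + c) + length Ds * c       ≡⟨ ℕ.+-assoc (countᵇ (outside (D ∷ Ds)) xs) c (length Ds * c) ⟩
    countᵇ (outside (D ∷ Ds)) xs + length (D ∷ Ds) * c       ∎
    where open ℕ.≤-Reasoning

module _ {k : ℕ} where

  card≡countᵇ : (X : Subset k) → card X ≡ countᵇ X (allPoints k)
  card≡countᵇ X = go (allPoints k)
    where
    go : ∀ xs → length (filter (λ x → X x ≟ᵇ true) xs) ≡ countᵇ X xs
    go [] = refl
    go (x ∷ xs) with X x
    ... | true = cong suc (go xs)
    ... | false = go xs

  card-∅ : card {k} (λ _ → false) ≡ 0
  card-∅ = trans (card≡countᵇ _) (countᵇ-false (allPoints k))

  card-cong : {X Y : Subset k} → X ≗ Y → card X ≡ card Y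
  card-cong {X} {Y} X≗Y =
    trans (card≡countᵇ X) (trans (countᵇ-cong X≗Y (allPoints k)) (sym (card≡countᵇ Y)))

length-allPoints : ∀ k → length (allPoints k) ≡ 2 ^ k
length-allPoints zero = refl
length-allPoints (suc k) = begin
  length (map (true ∷_) ps ++ map (false ∷_) ps)          ≡⟨ List.length-++ (map (true ∷_) ps) ⟩
  length (map (true ∷_) ps) + length (map (false ∷_) ps)  ≡⟨ cong₂ _+_ (List.length-map _ ps) (List.length-map _ ps) ⟩
  length ps + length ps                                   ≡⟨ cong (λ n → n + n) (length-allPoints k) ⟩
  2 ^ k + 2 ^ k                                           ≡⟨ cong (λ n → 2 ^ k + n) (sym (ℕ.+-identityʳ (2 ^ k))) ⟩
  2 ^ suc k                                               ∎
  where
  open ≡-Reasoning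
  ps : List (Point k)
  ps = allPoints k

∈-allPoints : ∀ {k} (x : Point k) → x ∈ allPoints k
∈-allPoints [] = here refl
∈-allPoints (true ∷ x) = ∈-++⁺ˡ (∈-map⁺ (true ∷_) (∈-allPoints x))
∈-allPoints (false ∷ x) = ∈-++⁺ʳ (map (true ∷_) (allPoints _)) (∈-map⁺ (false ∷_) (∈-allPoints x))

module _ {k : ℕ} where

  _≟ₛ_ : (X Y : Subset k) → Dec (X ≗ Y)
  X ≟ₛ Y with All.all? (λ x → X x ≟ᵇ Y x) (allPoints k)
  ... | yes agree = yes (λ x → All.lookup agree (∈-allPoints x))
  ... | no disagree = no (λ X≗Y → disagree (All.tabulate (λ {x} _ → X≗Y x)))

  sameRect? : (R S : Rect k) → Dec (SameRect R S)
  sameRect? (U , V) (U′ , V′) = (U ≟ₛ U′) ×-dec (V ≟ₛ V′)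

  meets-cong : ∀ {R S : Rect k} {X X′ Y Y′} → SameRect R S → X ≗ X′ → Y ≗ Y′ → meets R X Y ≡ meets S X′ Y′
  meets-cong (U≗U′ , V≗V′) X≗X′ Y≗Y′ = cong₂ _∧_
    (any-cong (λ x → cong₂ _∧_ (U≗U′ x) (X≗X′ x)) (allPoints k))
    (any-cong (λ y → cong₂ _∧_ (V≗V′ y) (Y≗Y′ y)) (allPoints k))

  meets⇒common-points : ∀ U V (X Y : Subset k) → meets (U , V) X Y ≡ true →
    Σ (Point k) λ x → Σ (Point k) λ y → (U x ≡ true × X x ≡ true) × (V y ≡ true × Y y ≡ true)
  meets⇒common-points U V X Y meet with ∧≡true⇒ meet
  ... | meetˡ , meetʳ with any≡true⇒ _ (allPoints k) meetˡ | any≡true⇒ _ (allPoints k) meetʳ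
  ... | x , Ux∧Xx | y , Vy∧Yy = x , y , ∧≡true⇒ Ux∧Xx , ∧≡true⇒ Vy∧Yy

  meets-disjointˡ : ∀ U V (X Y : Subset k) → (∀ x → U x ≡ true → X x ≡ false) → meets (U , V) X Y ≡ false
  meets-disjointˡ U V X Y U∩X≡∅ = cong (_∧ _) (any-disjoint U X U∩X≡∅ (allPoints k))

  meets-disjointʳ : ∀ U V (X Y : Subset k) → (∀ y → V y ≡ true → Y y ≡ false) → meets (U , V) X Y ≡ false
  meets-disjointʳ U V X Y V∩Y≡∅ = trans (cong (_ ∧_) (any-disjoint V Y V∩Y≡∅ (allPoints k))) (∧-zeroʳ _)

  hitProb-cong : (μ : Dist k) {X X′ Y Y′ : Subset k} → X ≗ X′ → Y ≗ Y′ → hitProb μ X Y ≡ hitProb μ X′ Y′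
  hitProb-cong [] X≗X′ Y≗Y′ = refl
  hitProb-cong ((R , w) ∷ μ) X≗X′ Y≗Y′
    rewrite meets-cong {R} {R} ((λ _ → refl) , (λ _ → refl)) X≗X′ Y≗Y′ | hitProb-cong μ X≗X′ Y≗Y′ = refl

  hitProb-≡0 : (μ : Dist k) {X Y : Subset k} → All (λ e → meets (proj₁ e) X Y ≡ false) μ → hitProb μ X Y ≡ 0ℚ
  hitProb-≡0 [] [] = refl
  hitProb-≡0 (e ∷ μ) (miss ∷ misses) rewrite miss | hitProb-≡0 μ misses = refl

  hitProb>0⇒meets : (μ : Dist k) {X Y : Subset k} → 0ℚ < hitProb μ X Y → Any (λ e → meets (proj₁ e) X Y ≡ true) μ
  hitProb>0⇒meets [] 0<0 = ⊥-elim (ℚ.<-irrefl refl 0<0)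
  hitProb>0⇒meets ((R , w) ∷ μ) {X} {Y} 0<p with meets R X Y in meet
  ... | true = here meet
  ... | false = there (hitProb>0⇒meets μ (subst (0ℚ <_) (ℚ.+-identityˡ _) 0<p))

-- Lower bound on the support

0<1-δ : ∀ {δ} → δ < 1ℚ → 0ℚ < 1ℚ -ℚ δ
0<1-δ {δ} δ<1 = subst (_< 1ℚ -ℚ δ) (ℚ.+-inverseʳ δ) (ℚ.+-monoˡ-< (- δ) δ<1)

2^h*[2^[k∸h]∸1]<2^k : ∀ k h → 2 ^ h * (2 ^ (k ∸ h) ∸ 1) <ℕ 2 ^ k
2^h*[2^[k∸h]∸1]<2^k k h with ℕ.≤-total h k
... | inj₁ h≤k = subst (_<ℕ 2 ^ k) (sym 2^h*[2^[k∸h]∸1]≡2^k∸2^h) 2^k∸2^h<2^k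
  where
  open ≡-Reasoning
  2^h*[2^[k∸h]∸1]≡2^k∸2^h : 2 ^ h * (2 ^ (k ∸ h) ∸ 1) ≡ 2 ^ k ∸ 2 ^ h
  2^h*[2^[k∸h]∸1]≡2^k∸2^h = begin
    2 ^ h * (2 ^ (k ∸ h) ∸ 1)        ≡⟨ ℕ.*-distribˡ-∸ (2 ^ h) (2 ^ (k ∸ h)) 1 ⟩
    2 ^ h * 2 ^ (k ∸ h) ∸ 2 ^ h * 1  ≡⟨ cong₂ _∸_ (sym (ℕ.^-distribˡ-+-* 2 h (k ∸ h))) (ℕ.*-identityʳ (2 ^ h)) ⟩
    2 ^ (h + (k ∸ h)) ∸ 2 ^ h        ≡⟨ cong (λ n → 2 ^ n ∸ 2 ^ h) (ℕ.m+[n∸m]≡n h≤k) ⟩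
    2 ^ k ∸ 2 ^ h                    ∎
  2^k∸2^h<2^k : 2 ^ k ∸ 2 ^ h <ℕ 2 ^ k
  2^k∸2^h<2^k = ℕ.∸-monoʳ-< {2 ^ k} {2 ^ h} {0} (ℕ.m^n>0 2 h) (ℕ.^-monoʳ-≤ 2 h≤k)
... | inj₂ k≤h rewrite ℕ.m≤n⇒m∸n≡0 k≤h | ℕ.*-zeroʳ (2 ^ h) = ℕ.m^n>0 2 k

Large : ∀ {k} → ℕ → Subset k → Set
Large {k} h X = 2 ^ (k ∸ h) ≤ℕ card X

Large? : ∀ {k} h (X : Subset k) → Dec (Large h X)
Large? {k} h X = 2 ^ (k ∸ h) ≤? card X

outside-large : ∀ {k} h (Ds : List (Subset k)) → All (λ D → card D <ℕ 2 ^ (k ∸ h)) Ds → length Ds <ℕ 2 ^ h →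
  Large h (outside Ds)
outside-large {k} h Ds small few =
  ℕ.≮⇒≥ λ lt → ℕ.<-irrefl refl (ℕ.<-≤-trans (2^h*[2^[k∸h]∸1]<2^k k h) (2^k≤2^h*[t∸1] lt))
  where
  t : ℕ
  t = 2 ^ (k ∸ h)
  open ℕ.≤-Reasoning
  ≤t∸1 : ∀ D → card D <ℕ t → countᵇ D (allPoints k) ≤ℕ t ∸ 1
  ≤t∸1 D lt = ℕ.<⇒≤pred (subst (_<ℕ t) (card≡countᵇ D) lt)
  2^k≤2^h*[t∸1] : card (outside Ds) <ℕ t → 2 ^ k ≤ℕ 2 ^ h * (t ∸ 1)
  2^k≤2^h*[t∸1] lt = begin
    2 ^ k                                           ≡⟨ sym (length-allPoints k) ⟩
    length (allPoints k)                            ≤⟨ length≤countᵇ-outside+length*c (allPoints k) (t ∸ 1) Ds (All.map (≤t∸1 _) small) ⟩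
    countᵇ (outside Ds) (allPoints k) + length Ds * (t ∸ 1) ≤⟨ ℕ.+-monoˡ-≤ (length Ds * (t ∸ 1)) (≤t∸1 (outside Ds) lt) ⟩
    suc (length Ds) * (t ∸ 1)                       ≤⟨ ℕ.*-monoˡ-≤ (t ∸ 1) few ⟩
    2 ^ h * (t ∸ 1)                                 ∎

module _ {k : ℕ} (h : ℕ) where

  blockedˡ blockedʳ : Rect k → Subset k
  blockedˡ (U , V) with Large? h U
  ... | yes _ = λ _ → false
  ... | no _ = U
  blockedʳ (U , V) with Large? h U
  ... | yes _ = V
  ... | no _ = λ _ → false

  card-blockedˡ : ∀ R → card (blockedˡ R) <ℕ 2 ^ (k ∸ h)
  card-blockedˡ (U , V) with Large? h U
  ... | yes _ = subst (_<ℕ 2 ^ (k ∸ h)) (sym (card-∅ {k})) (ℕ.m^n>0 2 (k ∸ h))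
  ... | no ¬lU = ℕ.≰⇒> ¬lU

  card-blockedʳ : ∀ {U V} → (Large h U → ¬ Large h V) → card (blockedʳ (U , V)) <ℕ 2 ^ (k ∸ h)
  card-blockedʳ {U} thin with Large? h U
  ... | yes lU = ℕ.≰⇒> (thin lU)
  ... | no _ = subst (_<ℕ 2 ^ (k ∸ h)) (sym (card-∅ {k})) (ℕ.m^n>0 2 (k ∸ h))

  blockedˡ-narrow : ∀ {U V} → ¬ Large h U → blockedˡ (U , V) ≗ U
  blockedˡ-narrow {U} ¬lU x with Large? h U
  ... | yes lU = ⊥-elim (¬lU lU)
  ... | no _ = refl

  blockedʳ-wide : ∀ {U V} → Large h U → blockedʳ (U , V) ≗ V
  blockedʳ-wide {U} lU y with Large? h U
  ... | yes _ = refl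
  ... | no ¬lU = ⊥-elim (¬lU lU)

  missed : ∀ {R Rs} → R ∈ Rs → meets R (outside (map blockedˡ Rs)) (outside (map blockedʳ Rs)) ≡ false
  missed {U , V} {Rs} R∈Rs with Large? h U
  ... | yes lU = meets-disjointʳ U V _ _ λ y Vy → outside-∉ (∈-map⁺ blockedʳ R∈Rs) (trans (blockedʳ-wide {U} {V} lU y) Vy)
  ... | no ¬lU = meets-disjointˡ U V _ _ λ x Ux → outside-∉ (∈-map⁺ blockedˡ R∈Rs) (trans (blockedˡ-narrow {U} {V} ¬lU x) Ux)

module _ {k : ℕ} (g : Fn k) {δ : ℚ} {h : ℕ} (δ<1 : δ < 1ℚ) where

  hitting⇒meets : {μ : Dist k} → Hitting δ h μ → ∀ {X Y} → Large h X → Large h Y → Any (λ e → meets (proj₁ e) X Y ≡ true) μ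
  hitting⇒meets {μ} hit {X} {Y} lX lY = hitProb>0⇒meets μ (ℚ.<-≤-trans (0<1-δ δ<1) (hit X Y lX lY))

  no-large-monochromatic : ∀ b {ν} → OverMono g (not b) ν → Hitting δ h ν →
    ∀ {U V} → Monochromatic g b (U , V) → Large h U → Large h V → ⊥
  no-large-monochromatic b {ν} monoν hitν {U} {V} monoUV lU lV = bichromatic (find (hitting⇒meets hitν lU lV))
    where
    bichromatic : Σ (Rect k × ℚ) (λ e → e ∈ ν × meets (proj₁ e) U V ≡ true) → ⊥
    bichromatic (((U′ , V′) , _) , e∈ν , meet) with meets⇒common-points U′ V′ U V meet
    ... | x , y , (U′x , Ux) , (V′y , Vy) = not-¬ (monoUV x y Ux Vy) (All.lookup monoν e∈ν x y U′x V′y)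

  support-lower-bound : ∀ b {μ ν} → OverMono g b μ → Hitting δ h μ → OverMono g (not b) ν → Hitting δ h ν →
    2 ^ h ≤ℕ length μ
  support-lower-bound b {μ} monoμ hitμ monoν hitν = ℕ.≮⇒≥ λ few →
    ℚ.<-irrefl (sym (hitProb-≡0 μ (All.tabulate (λ e∈μ → missed h (∈-map⁺ proj₁ e∈μ)))))
      (ℚ.<-≤-trans (0<1-δ δ<1) (hitμ X Y (large (blockedˡ h) (λ {R} _ → card-blockedˡ h R) few)
                                          (large (blockedʳ h) (λ R∈ → card-blockedʳ h (thin R∈)) few)))
    where
    Rs : List (Rect k)
    Rs = map proj₁ μ

    X Y : Subset k
    X = outside (map (blockedˡ h) Rs)
    Y = outside (map (blockedʳ h) Rs)

    thin : ∀ {U V} → (U , V) ∈ Rs → Large h U → ¬ Large h V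
    thin R∈ = no-large-monochromatic b monoν hitν (All.lookup (map⁺ monoμ) R∈)

    large : (f : Rect k → Subset k) → (∀ {R} → R ∈ Rs → card (f R) <ℕ 2 ^ (k ∸ h)) → length μ <ℕ 2 ^ h →
      Large h (outside (map f Rs))
    large f small few = outside-large h (map f Rs) (map⁺ (All.tabulate small))
      (subst (_<ℕ 2 ^ h) (sym (trans (List.length-map f Rs) (List.length-map proj₁ μ))) few)

fromℕ : ℕ → ℚ
fromℕ zero = 0ℚ
fromℕ (suc n) = 1ℚ +ℚ fromℕ n

fromℕ-+ : ∀ m n → fromℕ (m + n) ≡ fromℕ m +ℚ fromℕ n
fromℕ-+ zero n = sym (ℚ.+-identityˡ (fromℕ n))
fromℕ-+ (suc m) n = trans (cong (1ℚ +ℚ_) (fromℕ-+ m n)) (sym (ℚ.+-assoc 1ℚ (fromℕ m) (fromℕ n)))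

fromℕ-* : ∀ m n → fromℕ (m * n) ≡ fromℕ m *ℚ fromℕ n
fromℕ-* zero n = sym (ℚ.*-zeroˡ (fromℕ n))
fromℕ-* (suc m) n = begin
  fromℕ (n + m * n)                ≡⟨ fromℕ-+ n (m * n) ⟩
  fromℕ n +ℚ fromℕ (m * n)         ≡⟨ cong (fromℕ n +ℚ_) (fromℕ-* m n) ⟩
  fromℕ n +ℚ fromℕ m *ℚ fromℕ n    ≡⟨ solve 2 (λ x y → y :+ x :* y := (con 1ℚ :+ x) :* y) refl (fromℕ m) (fromℕ n) ⟩
  (1ℚ +ℚ fromℕ m) *ℚ fromℕ n       ∎
  where open ≡-Reasoning

fromℕ-nonNeg : ∀ n → 0ℚ ≤ fromℕ n
fromℕ-nonNeg zero = ℚ.≤-refl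
fromℕ-nonNeg (suc n) = ℚ.+-mono-≤ (ℚ.<⇒≤ (ℚ.positive⁻¹ 1ℚ)) (fromℕ-nonNeg n)

fromℕ-mono-≤ : ∀ {m n} → m ≤ℕ n → fromℕ m ≤ fromℕ n
fromℕ-mono-≤ {m} m≤n with ℕ.m≤n⇒∃[o]m+o≡n m≤n
... | d , refl = subst (_≤ fromℕ (m + d)) (ℚ.+-identityʳ (fromℕ m))
  (subst (fromℕ m +ℚ 0ℚ ≤_) (sym (fromℕ-+ m d)) (ℚ.+-monoʳ-≤ (fromℕ m) (fromℕ-nonNeg d)))

fromℕ-cancel-≤ : ∀ {m n} → fromℕ m ≤ fromℕ n → m ≤ℕ n
fromℕ-cancel-≤ {m} {n} fm≤fn = ℕ.≮⇒≥ λ n<m →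
  ℚ.<-irrefl refl (ℚ.<-≤-trans (ℚ.<-≤-trans fn<f1+n (fromℕ-mono-≤ n<m)) fm≤fn)
  where
  fn<f1+n : fromℕ n < fromℕ (suc n)
  fn<f1+n = subst (_< fromℕ (suc n)) (ℚ.+-identityˡ (fromℕ n)) (ℚ.+-monoˡ-< (fromℕ n) (ℚ.positive⁻¹ 1ℚ))

fromℕ>0 : ∀ m .{{_ : NonZero m}} → 0ℚ < fromℕ m
fromℕ>0 (suc m) = ℚ.<-≤-trans (ℚ.positive⁻¹ 1ℚ)
  (subst (_≤ fromℕ (suc m)) (ℚ.+-identityʳ 1ℚ) (ℚ.+-monoʳ-≤ 1ℚ (fromℕ-nonNeg m)))

∑ : {B : Set} → List B → (B → ℚ) → ℚ
∑ [] f = 0ℚ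
∑ (x ∷ xs) f = f x +ℚ ∑ xs f

module _ {B : Set} where

  ∑-cong : ∀ (xs : List B) {f g} → (∀ x → f x ≡ g x) → ∑ xs f ≡ ∑ xs g
  ∑-cong [] f≗g = refl
  ∑-cong (x ∷ xs) f≗g = cong₂ _+ℚ_ (f≗g x) (∑-cong xs f≗g)

  ∑-mono-≤ : ∀ (xs : List B) {f g} → All (λ x → f x ≤ g x) xs → ∑ xs f ≤ ∑ xs g
  ∑-mono-≤ [] [] = ℚ.≤-refl
  ∑-mono-≤ (x ∷ xs) (fx≤gx ∷ f≤g) = ℚ.+-mono-≤ fx≤gx (∑-mono-≤ xs f≤g)

  ∑-0 : ∀ (xs : List B) → ∑ xs (λ _ → 0ℚ) ≡ 0ℚ
  ∑-0 [] = refl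
  ∑-0 (x ∷ xs) = trans (ℚ.+-identityˡ _) (∑-0 xs)

  ∑-+ : ∀ (xs : List B) f g → ∑ xs f +ℚ ∑ xs g ≡ ∑ xs (λ x → f x +ℚ g x)
  ∑-+ [] f g = refl
  ∑-+ (x ∷ xs) f g = trans
    (solve 4 (λ a b c d → (a :+ b) :+ (c :+ d) := (a :+ c) :+ (b :+ d)) refl (f x) (∑ xs f) (g x) (∑ xs g))
    (cong ((f x +ℚ g x) +ℚ_) (∑-+ xs f g))

  ∑-*ˡ : ∀ (xs : List B) c f → c *ℚ ∑ xs f ≡ ∑ xs (λ x → c *ℚ f x)
  ∑-*ˡ [] c f = ℚ.*-zeroʳ c
  ∑-*ˡ (x ∷ xs) c f = trans (ℚ.*-distribˡ-+ c (f x) (∑ xs f)) (cong (c *ℚ f x +ℚ_) (∑-*ˡ xs c f))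

  ∑-*ʳ : ∀ (xs : List B) f c → ∑ xs (λ x → f x *ℚ c) ≡ ∑ xs f *ℚ c
  ∑-*ʳ xs f c = trans (∑-cong xs (λ x → ℚ.*-comm (f x) c)) (trans (sym (∑-*ˡ xs c f)) (ℚ.*-comm c (∑ xs f)))

  fromℕ-sum : ∀ (xs : List B) (f : B → ℕ) → fromℕ (sum (map f xs)) ≡ ∑ xs (fromℕ ∘ f)
  fromℕ-sum [] f = refl
  fromℕ-sum (x ∷ xs) f = trans (fromℕ-+ (f x) (sum (map f xs))) (cong (fromℕ (f x) +ℚ_) (fromℕ-sum xs f))

∈⇒≤sum : ∀ {n ns} → n ∈ ns → n ≤ℕ sum ns
∈⇒≤sum {ns = n ∷ ns} (here refl) = ℕ.m≤m+n n (sum ns)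
∈⇒≤sum {ns = m ∷ ns} (there n∈ns) = ℕ.≤-trans (∈⇒≤sum n∈ns) (ℕ.m≤n+m (sum ns) m)

Weighted : Set → Set
Weighted A = List (A × ℚ)

x<y⇒x*w<w*y : ∀ {w x y} → 0ℚ < w → x < y → x *ℚ w < w *ℚ y
x<y⇒x*w<w*y {w} {x} {y} w>0 x<y = subst (x *ℚ w <_) (ℚ.*-comm y w) (ℚ.*-monoˡ-<-pos w {{positive w>0}} x<y)

cost : Bool → ℕ
cost true = 1
cost false = 2

module _ {A : Set} where

  mass : Weighted A → ℚ
  mass = foldr (λ p s → proj₂ p +ℚ s) 0ℚ

  Pr : Weighted A → (A → Bool) → ℚ
  Pr μ p = foldr (λ e s → (if p (proj₁ e) then proj₂ e else 0ℚ) +ℚ s) 0ℚ μ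

  𝔼 : Weighted A → (A → ℚ) → ℚ
  𝔼 [] f = 0ℚ
  𝔼 ((a , w) ∷ μ) f = w *ℚ f a +ℚ 𝔼 μ f

  𝔼-cong : ∀ (μ : Weighted A) {f g} → (∀ a → f a ≡ g a) → 𝔼 μ f ≡ 𝔼 μ g
  𝔼-cong [] f≗g = refl
  𝔼-cong ((a , w) ∷ μ) f≗g = cong₂ (λ x y → w *ℚ x +ℚ y) (f≗g a) (𝔼-cong μ f≗g)

  𝔼-∑-comm : ∀ (μ : Weighted A) {B} (xs : List B) (c : B → ℚ) (f : A → B → ℚ) →
    𝔼 μ (λ a → ∑ xs (λ x → c x *ℚ f a x)) ≡ ∑ xs (λ x → c x *ℚ 𝔼 μ (λ a → f a x))
  𝔼-∑-comm [] xs c f = sym (trans (∑-cong xs (λ x → ℚ.*-zeroʳ (c x))) (∑-0 xs))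
  𝔼-∑-comm ((a , w) ∷ μ) xs c f = begin
    w *ℚ ∑ xs (λ x → c x *ℚ f a x) +ℚ 𝔼 μ (λ a → ∑ xs (λ x → c x *ℚ f a x))
      ≡⟨ cong₂ _+ℚ_ (∑-*ˡ xs w (λ x → c x *ℚ f a x)) (𝔼-∑-comm μ xs c f) ⟩
    ∑ xs (λ x → w *ℚ (c x *ℚ f a x)) +ℚ ∑ xs (λ x → c x *ℚ 𝔼 μ (λ a → f a x))
      ≡⟨ ∑-+ xs _ _ ⟩
    ∑ xs (λ x → w *ℚ (c x *ℚ f a x) +ℚ c x *ℚ 𝔼 μ (λ a → f a x))
      ≡⟨ ∑-cong xs (λ x → solve 4 (λ w c y e → w :* (c :* y) :+ c :* e := c :* (w :* y :+ e)) refl w (c x) (f a x) (𝔼 μ (λ a → f a x))) ⟩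
    ∑ xs (λ x → c x *ℚ (w *ℚ f a x +ℚ 𝔼 μ (λ a → f a x)))
      ∎
    where open ≡-Reasoning

  𝔼-cost+Pr : ∀ (μ : Weighted A) (p : A → Bool) → 𝔼 μ (λ a → fromℕ (cost (p a))) +ℚ Pr μ p ≡ fromℕ 2 *ℚ mass μ
  𝔼-cost+Pr [] p = refl
  𝔼-cost+Pr ((a , w) ∷ μ) p = begin
    w *ℚ fromℕ (cost (p a)) +ℚ E +ℚ ((if p a then w else 0ℚ) +ℚ P) ≡⟨ regroup (p a) ⟩
    fromℕ 2 *ℚ w +ℚ (E +ℚ P)                                         ≡⟨ cong (fromℕ 2 *ℚ w +ℚ_) (𝔼-cost+Pr μ p) ⟩
    fromℕ 2 *ℚ w +ℚ fromℕ 2 *ℚ mass μ                                ≡⟨ sym (ℚ.*-distribˡ-+ (fromℕ 2) w (mass μ)) ⟩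
    fromℕ 2 *ℚ (w +ℚ mass μ)                                         ∎
    where
    open ≡-Reasoning
    E P : ℚ
    E = 𝔼 μ (λ a → fromℕ (cost (p a)))
    P = Pr μ p
    regroup : ∀ b → w *ℚ fromℕ (cost b) +ℚ E +ℚ ((if b then w else 0ℚ) +ℚ P) ≡ fromℕ 2 *ℚ w +ℚ (E +ℚ P)
    regroup true = solve 3 (λ w e p → w :* con (fromℕ 1) :+ e :+ (w :+ p) := con (fromℕ 2) :* w :+ (e :+ p)) refl w E P
    regroup false = solve 3 (λ w e p → w :* con (fromℕ 2) :+ e :+ (con 0ℚ :+ p) := con (fromℕ 2) :* w :+ (e :+ p)) refl w E P

  𝔼-cost≤1+δ : ∀ (μ : Weighted A) (p : A → Bool) {δ} → mass μ ≡ 1ℚ → 1ℚ -ℚ δ ≤ Pr μ p →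
    𝔼 μ (λ a → fromℕ (cost (p a))) ≤ 1ℚ +ℚ δ
  𝔼-cost≤1+δ μ p {δ} normalised likely = begin
    E                         ≡⟨ solve 2 (λ e p → e := (e :+ p) :- p) refl E (Pr μ p) ⟩
    (E +ℚ Pr μ p) -ℚ Pr μ p   ≡⟨ cong (_-ℚ Pr μ p) (trans (𝔼-cost+Pr μ p) (cong (fromℕ 2 *ℚ_) normalised)) ⟩
    fromℕ 2 *ℚ 1ℚ -ℚ Pr μ p   ≤⟨ ℚ.+-monoʳ-≤ (fromℕ 2 *ℚ 1ℚ) (ℚ.neg-antimono-≤ likely) ⟩
    fromℕ 2 *ℚ 1ℚ -ℚ (1ℚ -ℚ δ) ≡⟨ solve 1 (λ d → con (fromℕ 2) :* con 1ℚ :- (con 1ℚ :- d) := con 1ℚ :+ d) refl δ ⟩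
    1ℚ +ℚ δ                   ∎
    where
    open ℚ.≤-Reasoning
    E : ℚ
    E = 𝔼 μ (λ a → fromℕ (cost (p a)))

  *mass≤𝔼 : ∀ (μ : Weighted A) f {B} → All (λ e → 0ℚ < proj₂ e) μ → All (λ e → B < f (proj₁ e)) μ →
    B *ℚ mass μ ≤ 𝔼 μ f
  *mass≤𝔼 [] f {B} [] [] = ℚ.≤-reflexive (ℚ.*-zeroʳ B)
  *mass≤𝔼 ((a , w) ∷ μ) f {B} (w>0 ∷ pos) (B<fa ∷ B<f) = begin
    B *ℚ (w +ℚ mass μ)         ≡⟨ ℚ.*-distribˡ-+ B w (mass μ) ⟩
    B *ℚ w +ℚ B *ℚ mass μ      ≤⟨ ℚ.+-mono-≤ (ℚ.<⇒≤ (x<y⇒x*w<w*y w>0 B<fa)) (*mass≤𝔼 μ f pos B<f) ⟩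
    w *ℚ f a +ℚ 𝔼 μ f          ∎
    where open ℚ.≤-Reasoning

  averaging : ∀ (μ : Weighted A) f {B} → All (λ e → 0ℚ < proj₂ e) μ → mass μ ≡ 1ℚ → 𝔼 μ f ≤ B →
    Σ (A × ℚ) λ e → e ∈ μ × f (proj₁ e) ≤ B
  averaging [] f pos () 𝔼≤B
  averaging μ@((a , w) ∷ ν) f {B} pos@(w>0 ∷ posν) normalised 𝔼≤B with any? (λ e → f (proj₁ e) ℚ.≤? B) μ
  ... | yes some = find some
  ... | no none = ⊥-elim (ℚ.<-irrefl refl (ℚ.<-≤-trans B<𝔼 𝔼≤B))
    where
    open ℚ.≤-Reasoning
    B<fa : All (λ e → B < f (proj₁ e)) μ
    B<fa = All.map ℚ.≰⇒> (¬Any⇒All¬ μ none)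
    B<𝔼 : B < 𝔼 μ f
    B<𝔼 = begin-strict
      B                          ≡⟨ sym (trans (cong (B *ℚ_) normalised) (ℚ.*-identityʳ B)) ⟩
      B *ℚ (w +ℚ mass ν)         ≡⟨ ℚ.*-distribˡ-+ B w (mass ν) ⟩
      B *ℚ w +ℚ B *ℚ mass ν      <⟨ ℚ.+-mono-<-≤ (x<y⇒x*w<w*y w>0 (All.head B<fa)) (*mass≤𝔼 ν f posν (All.tail B<fa)) ⟩
      w *ℚ f a +ℚ 𝔼 ν f          ∎

-- Derandomised sampling

^-distribʳ-* : ∀ m n o → (m * n) ^ o ≡ m ^ o * n ^ o
^-distribʳ-* m n zero = refl
^-distribʳ-* m n (suc o) = trans (cong (m * n *_) (^-distribʳ-* m n o)) (interchange m n (m ^ o) (n ^ o))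

21^[40n]*2^n<20^[40n]*2^[4n] : ∀ n .{{_ : NonZero n}} → 21 ^ (40 * n) * 2 ^ n <ℕ 20 ^ (40 * n) * 2 ^ (4 * n)
21^[40n]*2^n<20^[40n]*2^[4n] n = subst₂ _<ℕ_
  (trans (distrib 21 2 1) (cong (λ m → 21 ^ (40 * n) * 2 ^ m) (ℕ.*-identityˡ n)))
  (distrib 20 2 4)
  (ℕ.^-monoˡ-< n 21^40*2<20^40*2^4)
  where
  21^40*2<20^40*2^4 : 21 ^ 40 * 2 ^ 1 <ℕ 20 ^ 40 * 2 ^ 4
  21^40*2<20^40*2^4 = ℕ.≤ᵇ⇒≤ (suc (21 ^ 40 * 2 ^ 1)) (20 ^ 40 * 2 ^ 4) _
  distrib : ∀ a b c → (a ^ 40 * b ^ c) ^ n ≡ a ^ (40 * n) * b ^ (c * n)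
  distrib a b c = trans (^-distribʳ-* (a ^ 40) (b ^ c) n) (cong₂ _*_ (ℕ.^-*-assoc a 40 n) (ℕ.^-*-assoc b c n))

module Derandomisation {A T : Set} (pass : A → T → Bool) (Ts : List T) (μ : Weighted A)
  (weights>0 : All (λ e → 0ℚ < proj₂ e) μ) (normalised : mass μ ≡ 1ℚ)
  (likely : All (λ t → 1ℚ -ℚ + 1 / 20 ≤ Pr μ (λ a → pass a t)) Ts) where

  passes failures : List A → T → ℕ
  passes s t = countᵇ (λ a → pass a t) s
  failures s t = countᵇ (λ a → not (pass a t)) s

  Φ : List A → ℕ
  Φ s = sum (map (λ t → 2 ^ failures s t) Ts)

  2^failures-∷ : ∀ a s t → 2 ^ failures (a ∷ s) t ≡ 2 ^ failures s t * cost (pass a t)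
  2^failures-∷ a s t with pass a t
  ... | true = sym (ℕ.*-identityʳ _)
  ... | false = ℕ.*-comm 2 (2 ^ failures s t)

  𝔼Φ-∷ : ∀ s → 𝔼 μ (λ a → fromℕ (Φ (a ∷ s))) ≤ fromℕ (Φ s) *ℚ (1ℚ +ℚ + 1 / 20)
  𝔼Φ-∷ s = begin
    𝔼 μ (λ a → fromℕ (Φ (a ∷ s)))                               ≡⟨ 𝔼-cong μ Φ-∷ ⟩
    𝔼 μ (λ a → ∑ Ts (λ t → c t *ℚ fromℕ (cost (pass a t))))      ≡⟨ 𝔼-∑-comm μ Ts c (λ a t → fromℕ (cost (pass a t))) ⟩
    ∑ Ts (λ t → c t *ℚ 𝔼 μ (λ a → fromℕ (cost (pass a t))))     ≤⟨ ∑-mono-≤ Ts (All.map scale likely) ⟩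
    ∑ Ts (λ t → c t *ℚ (1ℚ +ℚ + 1 / 20))                         ≡⟨ ∑-*ʳ Ts c _ ⟩
    ∑ Ts c *ℚ (1ℚ +ℚ + 1 / 20)                                   ≡⟨ cong (_*ℚ _) (sym (fromℕ-sum Ts _)) ⟩
    fromℕ (Φ s) *ℚ (1ℚ +ℚ + 1 / 20)                              ∎
    where
    open ℚ.≤-Reasoning
    c : T → ℚ
    c t = fromℕ (2 ^ failures s t)
    Φ-∷ : ∀ a → fromℕ (Φ (a ∷ s)) ≡ ∑ Ts (λ t → c t *ℚ fromℕ (cost (pass a t)))
    Φ-∷ a = trans (fromℕ-sum Ts _) (∑-cong Ts λ t → trans (cong fromℕ (2^failures-∷ a s t)) (fromℕ-* (2 ^ failures s t) (cost (pass a t))))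
    scale : ∀ {t} → 1ℚ -ℚ + 1 / 20 ≤ Pr μ (λ a → pass a t) →
      c t *ℚ 𝔼 μ (λ a → fromℕ (cost (pass a t))) ≤ c t *ℚ (1ℚ +ℚ + 1 / 20)
    scale {t} l = ℚ.*-monoˡ-≤-nonNeg (c t) {{nonNegative (fromℕ-nonNeg (2 ^ failures s t))}} (𝔼-cost≤1+δ μ (λ a → pass a t) {+ 1 / 20} normalised l)

  step : ∀ s → Σ A λ a → a ∈ map proj₁ μ × 20 * Φ (a ∷ s) ≤ℕ 21 * Φ s
  step s = pick (averaging μ (λ a → fromℕ (Φ (a ∷ s))) weights>0 normalised (𝔼Φ-∷ s))
    where
    r : ℚ
    r = 1ℚ +ℚ + 1 / 20
    open ℚ.≤-Reasoning
    pick : Σ (A × ℚ) (λ e → e ∈ μ × fromℕ (Φ (proj₁ e ∷ s)) ≤ fromℕ (Φ s) *ℚ r) →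
      Σ A λ a → a ∈ map proj₁ μ × 20 * Φ (a ∷ s) ≤ℕ 21 * Φ s
    pick ((a , _) , e∈μ , Φ≤) = a , ∈-map⁺ proj₁ e∈μ , fromℕ-cancel-≤ {20 * Φ (a ∷ s)} {21 * Φ s} (begin
      fromℕ (20 * Φ (a ∷ s))                          ≡⟨ fromℕ-* 20 (Φ (a ∷ s)) ⟩
      fromℕ 20 *ℚ fromℕ (Φ (a ∷ s))                   ≤⟨ ℚ.*-monoˡ-≤-nonNeg (fromℕ 20) {{nonNegative (fromℕ-nonNeg 20)}} Φ≤ ⟩
      fromℕ 20 *ℚ (fromℕ (Φ s) *ℚ r)                  ≡⟨ ℚ.*-comm (fromℕ 20) (fromℕ (Φ s) *ℚ r) ⟩
      (fromℕ (Φ s) *ℚ r) *ℚ fromℕ 20                  ≡⟨ ℚ.*-assoc (fromℕ (Φ s)) r (fromℕ 20) ⟩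
      fromℕ (Φ s) *ℚ (r *ℚ fromℕ 20)                  ≡⟨ ℚ.*-comm (fromℕ (Φ s)) (fromℕ 21) ⟩
      fromℕ 21 *ℚ fromℕ (Φ s)                         ≡⟨ sym (fromℕ-* 21 (Φ s)) ⟩
      fromℕ (21 * Φ s)                                ∎)

  sample : ∀ m → Σ (List A) λ s → length s ≡ m × All (_∈ map proj₁ μ) s × 20 ^ m * Φ s ≤ℕ 21 ^ m * length Ts
  sample zero = [] , refl , [] , ℕ.*-monoʳ-≤ 1 (ℕ.≤-reflexive (Φ[]≡length Ts))
    where
    Φ[]≡length : ∀ ts → sum (map (λ t → 2 ^ failures [] t) ts) ≡ length ts
    Φ[]≡length [] = refl
    Φ[]≡length (_ ∷ ts) = cong suc (Φ[]≡length ts)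
  sample (suc m) = extend (sample m)
    where
    open ℕ.≤-Reasoning
    extend : (Σ (List A) λ s → length s ≡ m × All (_∈ map proj₁ μ) s × 20 ^ m * Φ s ≤ℕ 21 ^ m * length Ts) →
      Σ (List A) λ s → length s ≡ suc m × All (_∈ map proj₁ μ) s × 20 ^ suc m * Φ s ≤ℕ 21 ^ suc m * length Ts
    extend (s , len , sampled , bound) = grow (step s)
      where
      grow : (Σ A λ a → a ∈ map proj₁ μ × 20 * Φ (a ∷ s) ≤ℕ 21 * Φ s) →
        Σ (List A) λ s → length s ≡ suc m × All (_∈ map proj₁ μ) s × 20 ^ suc m * Φ s ≤ℕ 21 ^ suc m * length Ts
      grow (a , a∈μ , 20Φ≤21Φ) = a ∷ s , cong suc len , a∈μ ∷ sampled , (begin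
        20 ^ suc m * Φ (a ∷ s)        ≡⟨ ℕ.*-assoc 20 (20 ^ m) (Φ (a ∷ s)) ⟩
        20 * (20 ^ m * Φ (a ∷ s))     ≡⟨ x∙yz≈y∙xz 20 (20 ^ m) (Φ (a ∷ s)) ⟩
        20 ^ m * (20 * Φ (a ∷ s))     ≤⟨ ℕ.*-monoʳ-≤ (20 ^ m) 20Φ≤21Φ ⟩
        20 ^ m * (21 * Φ s)           ≡⟨ x∙yz≈y∙xz (20 ^ m) 21 (Φ s) ⟩
        21 * (20 ^ m * Φ s)           ≤⟨ ℕ.*-monoʳ-≤ 21 bound ⟩
        21 * (21 ^ m * length Ts)     ≡⟨ ℕ.*-assoc 21 (21 ^ m) (length Ts) ⟨
        21 ^ suc m * length Ts        ∎)

  derandomise : ∀ n .{{_ : NonZero n}} → length Ts ≤ℕ 2 ^ n →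
    Σ (List A) λ s → length s ≡ 40 * n × All (_∈ map proj₁ μ) s × All (λ t → 36 * n ≤ℕ passes s t) Ts
  derandomise n |Ts|≤2^n = select (sample (40 * n))
    where
    select : (Σ (List A) λ s → length s ≡ 40 * n × All (_∈ map proj₁ μ) s × 20 ^ (40 * n) * Φ s ≤ℕ 21 ^ (40 * n) * length Ts) →
      Σ (List A) λ s → length s ≡ 40 * n × All (_∈ map proj₁ μ) s × All (λ t → 36 * n ≤ℕ passes s t) Ts
    select (s , len , sampled , bound) = s , len , sampled , All.tabulate frequent
      where
      open ℕ.≤-Reasoning
      rare : ∀ {t} → t ∈ Ts → failures s t <ℕ 4 * n
      rare {t} t∈Ts = ℕ.≰⇒> λ 4n≤f → ℕ.<-irrefl refl (ℕ.<-≤-trans 2^f-bound (ℕ.*-monoʳ-≤ (20 ^ (40 * n)) (ℕ.^-monoʳ-≤ 2 4n≤f)))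
        where
        2^f-bound : 20 ^ (40 * n) * 2 ^ failures s t <ℕ 20 ^ (40 * n) * 2 ^ (4 * n)
        2^f-bound = begin-strict
          20 ^ (40 * n) * 2 ^ failures s t  ≤⟨ ℕ.*-monoʳ-≤ (20 ^ (40 * n)) (∈⇒≤sum (∈-map⁺ (λ t → 2 ^ failures s t) t∈Ts)) ⟩
          20 ^ (40 * n) * Φ s               ≤⟨ bound ⟩
          21 ^ (40 * n) * length Ts         ≤⟨ ℕ.*-monoʳ-≤ (21 ^ (40 * n)) |Ts|≤2^n ⟩
          21 ^ (40 * n) * 2 ^ n             <⟨ 21^[40n]*2^n<20^[40n]*2^[4n] n ⟩
          20 ^ (40 * n) * 2 ^ (4 * n)       ∎
      frequent : ∀ {t} → t ∈ Ts → 36 * n ≤ℕ passes s t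
      frequent {t} t∈Ts = ℕ.≮⇒≥ λ few → ℕ.<-irrefl refl (begin-strict
        40 * n                          ≡⟨ trans (sym len) (sym (countᵇ+countᵇ-not (λ a → pass a t) s)) ⟩
        passes s t + failures s t       <⟨ ℕ.+-mono-< few (rare t∈Ts) ⟩
        36 * n + 4 * n                  ≡⟨ ℕ.*-distribʳ-+ n 36 4 ⟨
        40 * n                          ∎)

-- Empirical distributions

module _ {k : ℕ} where

  sameRect-sym : {R S : Rect k} → SameRect R S → SameRect S R
  sameRect-sym (U≗U′ , V≗V′) = (λ x → sym (U≗U′ x)) , (λ y → sym (V≗V′ y))

  insert : Rect k → ℚ → Dist k → Dist k
  insert R w [] = (R , w) ∷ []
  insert R w ((S , v) ∷ ν) with sameRect? R S
  ... | yes _ = (S , v +ℚ w) ∷ ν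
  ... | no _ = (S , v) ∷ insert R w ν

  tally : ℚ → List (Rect k) → Dist k
  tally w [] = []
  tally w (R ∷ s) = insert R w (tally w s)

  insert-All : (Q : Rect k → Set) → ∀ {R} w ν → All (Q ∘ proj₁) ν → Q R → All (Q ∘ proj₁) (insert R w ν)
  insert-All Q w [] [] QR = QR ∷ []
  insert-All Q {R} w ((S , v) ∷ ν) (QS ∷ Qν) QR with sameRect? R S
  ... | yes _ = QS ∷ Qν
  ... | no _ = QS ∷ insert-All Q w ν Qν QR

  insert-weights>0 : ∀ R {w} ν → 0ℚ < w → All (λ e → 0ℚ < proj₂ e) ν → All (λ e → 0ℚ < proj₂ e) (insert R w ν)
  insert-weights>0 R [] w>0 [] = w>0 ∷ []
  insert-weights>0 R ((S , v) ∷ ν) w>0 (v>0 ∷ ν>0) with sameRect? R S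
  ... | yes _ = ℚ.+-mono-< v>0 w>0 ∷ ν>0
  ... | no _ = v>0 ∷ insert-weights>0 R ν w>0 ν>0

  insert-distinct : ∀ R w ν → AllPairs (λ p q → ¬ SameRect (proj₁ p) (proj₁ q)) ν →
    AllPairs (λ p q → ¬ SameRect (proj₁ p) (proj₁ q)) (insert R w ν)
  insert-distinct R w [] [] = [] ∷ []
  insert-distinct R w ((S , v) ∷ ν) (S∉ν ∷ distinct) with sameRect? R S
  ... | yes _ = S∉ν ∷ distinct
  ... | no R≉S = insert-All (λ T → ¬ SameRect S T) w ν S∉ν (R≉S ∘ sameRect-sym) ∷ insert-distinct R w ν distinct

  length-insert : ∀ R w ν → length (insert R w ν) ≤ℕ suc (length ν)
  length-insert R w [] = ℕ.≤-refl
  length-insert R w ((S , v) ∷ ν) with sameRect? R S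
  ... | yes _ = ℕ.n≤1+n _
  ... | no _ = s≤s (length-insert R w ν)

  mass-insert : ∀ R w ν → mass (insert R w ν) ≡ w +ℚ mass ν
  mass-insert R w [] = refl
  mass-insert R w ((S , v) ∷ ν) with sameRect? R S
  ... | yes _ = solve 3 (λ v w m → (v :+ w) :+ m := w :+ (v :+ m)) refl v w (mass ν)
  ... | no _ = trans (cong (v +ℚ_) (mass-insert R w ν)) (solve 3 (λ v w m → v :+ (w :+ m) := w :+ (v :+ m)) refl v w (mass ν))

  hitProb-insert : ∀ R w ν (X Y : Subset k) → hitProb (insert R w ν) X Y ≡ (if meets R X Y then w else 0ℚ) +ℚ hitProb ν X Y
  hitProb-insert R w [] X Y = refl
  hitProb-insert R w ((S , v) ∷ ν) X Y with sameRect? R S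
  ... | yes R≈S rewrite meets-cong {k} {R} {S} {X} {X} {Y} {Y} R≈S (λ _ → refl) (λ _ → refl) with meets S X Y
  ...   | true = solve 3 (λ v w h → (v :+ w) :+ h := w :+ (v :+ h)) refl v w (hitProb ν X Y)
  ...   | false = sym (ℚ.+-identityˡ _)
  hitProb-insert R w ((S , v) ∷ ν) X Y | no _ =
    trans (cong (hit S v +ℚ_) (hitProb-insert R w ν X Y)) (solve 3 (λ a b h → a :+ (b :+ h) := b :+ (a :+ h)) refl (hit S v) (hit R w) (hitProb ν X Y))
    where
    hit : Rect k → ℚ → ℚ
    hit T u = if meets T X Y then u else 0ℚ

  tally-All : (Q : Rect k → Set) → ∀ w s → All Q s → All (Q ∘ proj₁) (tally w s)
  tally-All Q w [] [] = []
  tally-All Q w (R ∷ s) (QR ∷ Qs) = insert-All Q w (tally w s) (tally-All Q w s Qs) QR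

  tally-weights>0 : ∀ {w} s → 0ℚ < w → All (λ e → 0ℚ < proj₂ e) (tally w s)
  tally-weights>0 [] w>0 = []
  tally-weights>0 (R ∷ s) w>0 = insert-weights>0 R (tally _ s) w>0 (tally-weights>0 s w>0)

  tally-distinct : ∀ w s → AllPairs (λ p q → ¬ SameRect (proj₁ p) (proj₁ q)) (tally w s)
  tally-distinct w [] = []
  tally-distinct w (R ∷ s) = insert-distinct R w (tally w s) (tally-distinct w s)

  length-tally : ∀ w s → length (tally w s) ≤ℕ length s
  length-tally w [] = z≤n
  length-tally w (R ∷ s) = ℕ.≤-trans (length-insert R w (tally w s)) (s≤s (length-tally w s))

  mass-tally : ∀ w s → mass (tally w s) ≡ fromℕ (length s) *ℚ w
  mass-tally w [] = sym (ℚ.*-zeroˡ w)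
  mass-tally w (R ∷ s) = begin
    mass (insert R w (tally w s))          ≡⟨ mass-insert R w (tally w s) ⟩
    w +ℚ mass (tally w s)                  ≡⟨ cong (w +ℚ_) (mass-tally w s) ⟩
    w +ℚ fromℕ (length s) *ℚ w             ≡⟨ solve 2 (λ w n → w :+ n :* w := (con 1ℚ :+ n) :* w) refl w (fromℕ (length s)) ⟩
    (1ℚ +ℚ fromℕ (length s)) *ℚ w          ∎
    where open ≡-Reasoning

  hitProb-tally : ∀ w s (X Y : Subset k) → hitProb (tally w s) X Y ≡ fromℕ (countᵇ (λ R → meets R X Y) s) *ℚ w
  hitProb-tally w [] X Y = sym (ℚ.*-zeroˡ w)
  hitProb-tally w (R ∷ s) X Y = trans (hitProb-insert R w (tally w s) X Y)
    (trans (cong ((if meets R X Y then w else 0ℚ) +ℚ_) (hitProb-tally w s X Y)) (count-step (meets R X Y)))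
    where
    c : ℕ
    c = countᵇ (λ R → meets R X Y) s
    count-step : ∀ b → (if b then w else 0ℚ) +ℚ fromℕ c *ℚ w ≡ fromℕ (if b then suc c else c) *ℚ w
    count-step true = solve 2 (λ w n → w :+ n :* w := (con 1ℚ :+ n) :* w) refl w (fromℕ c)
    count-step false = ℚ.+-identityˡ _

-- Enumerating pairs of large sets

glue : ∀ {k} → Subset k → Subset k → Subset (suc k)
glue X Y (true ∷ v) = X v
glue X Y (false ∷ v) = Y v

subsets : (k : ℕ) → List (Subset k)
subsets zero = (λ _ → true) ∷ (λ _ → false) ∷ []
subsets (suc k) = cartesianProductWith glue (subsets k) (subsets k)

≗-Point0 : {X Y : Subset 0} → X [] ≡ Y [] → X ≗ Y
≗-Point0 eq [] = eq

subsets-complete : ∀ {k} (X : Subset k) → Σ (Subset k) λ X′ → X′ ∈ subsets k × X ≗ X′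
subsets-complete {zero} X with X [] in X[]
... | true = _ , here refl , ≗-Point0 X[]
... | false = _ , there (here refl) , ≗-Point0 X[]
subsets-complete {suc k} X with subsets-complete (X ∘ (true ∷_)) | subsets-complete (X ∘ (false ∷_))
... | X₁ , X₁∈ , X≗X₁ | X₀ , X₀∈ , X≗X₀ = glue X₁ X₀ , ∈-cartesianProductWith⁺ glue X₁∈ X₀∈ , X≗glue
  where
  X≗glue : X ≗ glue X₁ X₀
  X≗glue (true ∷ v) = X≗X₁ v
  X≗glue (false ∷ v) = X≗X₀ v

length-cartesianProductWith : {A B C : Set} (f : A → B → C) (xs : List A) (ys : List B) →
  length (cartesianProductWith f xs ys) ≡ length xs * length ys
length-cartesianProductWith f [] ys = refl
length-cartesianProductWith f (x ∷ xs) ys = trans (List.length-++ (map (f x) ys))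
  (cong₂ _+_ (List.length-map (f x) ys) (length-cartesianProductWith f xs ys))

2^2^k*2^2^k≡2^2^[1+k] : ∀ k → 2 ^ 2 ^ k * 2 ^ 2 ^ k ≡ 2 ^ 2 ^ suc k
2^2^k*2^2^k≡2^2^[1+k] k = trans (sym (ℕ.^-distribˡ-+-* 2 (2 ^ k) (2 ^ k)))
  (cong (λ n → 2 ^ (2 ^ k + n)) (sym (ℕ.+-identityʳ (2 ^ k))))

length-subsets : ∀ k → length (subsets k) ≡ 2 ^ 2 ^ k
length-subsets zero = refl
length-subsets (suc k) = trans (length-cartesianProductWith glue (subsets k) (subsets k))
  (trans (cong (λ n → n * n) (length-subsets k)) (2^2^k*2^2^k≡2^2^[1+k] k))

module _ {k : ℕ} (h : ℕ) where

  LargePair? : (t : Subset k × Subset k) → Dec (Large h (proj₁ t) × Large h (proj₂ t))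
  LargePair? t = Large? h (proj₁ t) ×-dec Large? h (proj₂ t)

  largePairs : List (Subset k × Subset k)
  largePairs = filter LargePair? (cartesianProduct (subsets k) (subsets k))

  length-largePairs : length largePairs ≤ℕ 2 ^ 2 ^ suc k
  length-largePairs = ℕ.≤-trans (List.length-filter LargePair? (cartesianProduct (subsets k) (subsets k))) (ℕ.≤-reflexive (begin
    length (cartesianProduct (subsets k) (subsets k)) ≡⟨ length-cartesianProductWith _,_ (subsets k) (subsets k) ⟩
    length (subsets k) * length (subsets k)           ≡⟨ cong (λ m → m * m) (length-subsets k) ⟩
    2 ^ 2 ^ k * 2 ^ 2 ^ k                             ≡⟨ 2^2^k*2^2^k≡2^2^[1+k] k ⟩
    2 ^ 2 ^ suc k                                     ∎))
    where open ≡-Reasoning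

  largePairs-complete : ∀ {X Y} → Large h X → Large h Y →
    Σ (Subset k × Subset k) λ t → t ∈ largePairs × X ≗ proj₁ t × Y ≗ proj₂ t
  largePairs-complete {X} {Y} lX lY with subsets-complete X | subsets-complete Y
  ... | X′ , X′∈ , X≗X′ | Y′ , Y′∈ , Y≗Y′ =
    (X′ , Y′) , ∈-filter⁺ LargePair? (∈-cartesianProductWith⁺ _,_ X′∈ Y′∈) (large X≗X′ lX , large Y≗Y′ lY) , X≗X′ , Y≗Y′
    where
    large : ∀ {Z Z′} → Z ≗ Z′ → Large h Z → Large h Z′
    large Z≗Z′ = subst (2 ^ (k ∸ h) ≤ℕ_) (card-cong Z≗Z′)

-- Sparsification

fromℕ[36n]≡9/10*fromℕ[40n] : ∀ n → fromℕ (36 * n) ≡ + 9 / 10 *ℚ fromℕ (40 * n)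
fromℕ[36n]≡9/10*fromℕ[40n] n = begin
  fromℕ (36 * n)                    ≡⟨ fromℕ-* 36 n ⟩
  (+ 9 / 10 *ℚ fromℕ 40) *ℚ fromℕ n  ≡⟨ ℚ.*-assoc (+ 9 / 10) (fromℕ 40) (fromℕ n) ⟩
  + 9 / 10 *ℚ (fromℕ 40 *ℚ fromℕ n)  ≡⟨ cong (+ 9 / 10 *ℚ_) (fromℕ-* 40 n) ⟨
  + 9 / 10 *ℚ fromℕ (40 * n)        ∎
  where open ≡-Reasoning

tally-hitting : ∀ {k} h w s n → 0ℚ < w → fromℕ (40 * n) *ℚ w ≡ 1ℚ →
  All (λ t → 36 * n ≤ℕ countᵇ (λ R → meets R (proj₁ t) (proj₂ t)) s) (largePairs {k} h) →
  Hitting (+ 1 / 10) h (tally w s)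
tally-hitting h w s n w>0 40n*w≡1 frequent X Y lX lY with largePairs-complete h lX lY
... | t , t∈ , X≗ , Y≗ = begin
  1ℚ -ℚ + 1 / 10                    ≡⟨ cong (+ 9 / 10 *ℚ_) 40n*w≡1 ⟨
  + 9 / 10 *ℚ (fromℕ (40 * n) *ℚ w) ≡⟨ ℚ.*-assoc (+ 9 / 10) (fromℕ (40 * n)) w ⟨
  + 9 / 10 *ℚ fromℕ (40 * n) *ℚ w   ≡⟨ cong (_*ℚ w) (fromℕ[36n]≡9/10*fromℕ[40n] n) ⟨
  fromℕ (36 * n) *ℚ w               ≤⟨ ℚ.*-monoʳ-≤-nonNeg w {{nonNegative (ℚ.<⇒≤ w>0)}} (fromℕ-mono-≤ (All.lookup frequent t∈)) ⟩
  fromℕ (countᵇ (λ R → meets R (proj₁ t) (proj₂ t)) s) *ℚ w ≡⟨ hitProb-tally w s (proj₁ t) (proj₂ t) ⟨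
  hitProb (tally w s) (proj₁ t) (proj₂ t) ≡⟨ hitProb-cong (tally w s) X≗ Y≗ ⟨
  hitProb (tally w s) X Y           ∎
  where open ℚ.≤-Reasoning

module _ {k : ℕ} (g : Fn k) (h : ℕ) (b : Bool) where

  sparsify : ∀ μ → HittingMonoDist g b (+ 1 / 20) h μ →
    Σ (Dist k) λ ν → HittingMonoDist g b (+ 1 / 10) h ν × supportSize ν ≤ℕ 40 * 2 ^ suc k
  sparsify μ ((weights>0 , _ , normalised) , mono , hit) = conclude (derandomise n (length-largePairs {k} h))
    where
    pass : Rect k → Subset k × Subset k → Bool
    pass R t = meets R (proj₁ t) (proj₂ t)

    likely : All (λ t → 1ℚ -ℚ + 1 / 20 ≤ Pr μ (λ a → pass a t)) (largePairs h)
    likely = All.map (λ large → hit _ _ (proj₁ large) (proj₂ large))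
      (all-filter (LargePair? h) (cartesianProduct (subsets k) (subsets k)))

    open Derandomisation pass (largePairs h) μ weights>0 normalised likely

    n : ℕ
    n = 2 ^ suc k

    instance
      n≢0 : NonZero n
      n≢0 = ℕ.m^n≢0 2 (suc k)
      40n≢0 : NonZero (40 * n)
      40n≢0 = ℕ.m*n≢0 40 n
      40n>0 : Positive (fromℕ (40 * n))
      40n>0 = positive (fromℕ>0 (40 * n))
      40n≢0ℚ : NonZeroℚ (fromℕ (40 * n))
      40n≢0ℚ = ℚ.pos⇒nonZero (fromℕ (40 * n))

    w : ℚ
    w = 1/ fromℕ (40 * n)

    w>0 : 0ℚ < w
    w>0 = ℚ.positive⁻¹ w {{ℚ.1/pos⇒pos (fromℕ (40 * n))}}

    40n*w≡1 : fromℕ (40 * n) *ℚ w ≡ 1ℚ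
    40n*w≡1 = ℚ.*-inverseʳ (fromℕ (40 * n))

    conclude : (Σ (List (Rect k)) λ s → length s ≡ 40 * n × All (_∈ map proj₁ μ) s ×
                 All (λ t → 36 * n ≤ℕ passes s t) (largePairs h)) →
      Σ (Dist k) λ ν → HittingMonoDist g b (+ 1 / 10) h ν × supportSize ν ≤ℕ 40 * n
    conclude (s , len , sampled , frequent) =
      tally w s , ((tally-weights>0 s w>0 , tally-distinct w s , mass≡1) , mono-tally , tally-hitting h w s n w>0 40n*w≡1 frequent) ,
      ℕ.≤-trans (length-tally w s) (ℕ.≤-reflexive len)
      where
      mass≡1 : mass (tally w s) ≡ 1ℚ
      mass≡1 = trans (mass-tally w s) (trans (cong (λ m → fromℕ m *ℚ w) len) 40n*w≡1)

      mono-tally : OverMono g b (tally w s)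
      mono-tally = tally-All (Monochromatic g b) w s (All.map (All.lookup (map⁺ mono)) sampled)

nonempty-Point0 : (X : Subset 0) → 1 ≤ℕ card X → X [] ≡ true
nonempty-Point0 X 1≤|X| with X []
... | true = refl
nonempty-Point0 X () | false

module _ (g : Fn 0) {δ : ℚ} {h : ℕ} (δ<1 : δ < 1ℚ) (b : Bool) where

  single-rectangle : ∀ μ → HittingMonoDist g b δ h μ →
    Σ (Dist 0) λ ν → HittingMonoDist g b (+ 1 / 10) h ν × supportSize ν ≤ℕ 1
  single-rectangle μ (_ , mono , hit) = pick (find (hitting⇒meets g {h = h} δ<1 hit {full} {full} large-full large-full))
    where
    full : Subset 0
    full _ = true

    large-full : Large h full
    large-full = subst (_≤ℕ 1) (cong (2 ^_) (sym (ℕ.0∸n≡0 h))) ℕ.≤-refl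

    nonempty : ∀ X → Large h X → X ≗ full
    nonempty X lX = ≗-Point0 (nonempty-Point0 X (ℕ.≤-trans (ℕ.m^n>0 2 (0 ∸ h)) lX))

    pick : Σ (Rect 0 × ℚ) (λ e → e ∈ μ × meets (proj₁ e) full full ≡ true) →
      Σ (Dist 0) λ ν → HittingMonoDist g b (+ 1 / 10) h ν × supportSize ν ≤ℕ 1
    pick ((R , _) , e∈μ , meet) =
      (R , 1ℚ) ∷ [] , ((ℚ.positive⁻¹ 1ℚ ∷ [] , [] ∷ [] , ℚ.+-identityʳ 1ℚ) , All.lookup mono e∈μ ∷ [] , hitting) , ℕ.≤-refl
      where
      hitting : Hitting (+ 1 / 10) h ((R , 1ℚ) ∷ [])
      hitting X Y lX lY = subst (1ℚ -ℚ + 1 / 10 ≤_)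
        (sym (trans (hitProb-cong ((R , 1ℚ) ∷ []) (nonempty X lX) (nonempty Y lY)) (cong (λ c → (if c then 1ℚ else 0ℚ) +ℚ 0ℚ) meet)))
        (ℚ.≤ᵇ⇒≤ _)

40*2^[2+k]≤2^[8*[1+k]] : ∀ k → 40 * 2 ^ suc (suc k) ≤ℕ 2 ^ (8 * suc k)
40*2^[2+k]≤2^[8*[1+k]] k = begin
  40 * (2 * 2 ^ suc k)   ≡⟨ ℕ.*-assoc 40 2 (2 ^ suc k) ⟨
  80 * 2 ^ suc k         ≤⟨ ℕ.*-monoˡ-≤ (2 ^ suc k) (ℕ.≤ᵇ⇒≤ 80 (2 ^ 7) _) ⟩
  2 ^ 7 * 2 ^ suc k      ≡⟨ ℕ.^-distribˡ-+-* 2 7 (suc k) ⟨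
  2 ^ (7 + suc k)        ≤⟨ ℕ.^-monoʳ-≤ 2 (ℕ.+-monoˡ-≤ (suc k) (ℕ.m≤m*n 7 (suc k))) ⟩
  2 ^ (7 * suc k + suc k) ≡⟨ cong (2 ^_) (ℕ.+-comm (7 * suc k) (suc k)) ⟩
  2 ^ (8 * suc k)        ∎
  where open ℕ.≤-Reasoning

proposition4 : (Σ ℕ λ C → ∀ (k : ℕ) (g : Fn k) (h : ℕ) (b : Bool) →
    (Σ (Dist k) λ μ → HittingMonoDist g b (+ 1 / 20) h μ) →
    Σ (Dist k) λ ν → HittingMonoDist g b (+ 1 / 10) h ν × supportSize ν ≤ℕ 2 ^ (C * k))
    ×
    (∀ (k : ℕ) (g : Fn k) (δ : ℚ) (h : ℕ) → δ < 1ℚ → 1 ≤ℕ h →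
    (μ₀ μ₁ : Dist k) → HittingMonoDist g false δ h μ₀ → HittingMonoDist g true δ h μ₁ →
    (2 ^ h ≤ℕ supportSize μ₀) × (2 ^ h ≤ℕ supportSize μ₁))
proposition4 = (8 , sparse) , support-bounds
  where
  sparse : ∀ (k : ℕ) (g : Fn k) (h : ℕ) (b : Bool) →
    (Σ (Dist k) λ μ → HittingMonoDist g b (+ 1 / 20) h μ) →
    Σ (Dist k) λ ν → HittingMonoDist g b (+ 1 / 10) h ν × supportSize ν ≤ℕ 2 ^ (8 * k)
  sparse zero g h b (μ , hitting) = single-rectangle g {h = h} (toWitness {a? = + 1 / 20 ℚ.<? 1ℚ} _) b μ hitting
  sparse (suc k) g h b (μ , hitting) = map₂ (map₂ (λ small → ℕ.≤-trans small (40*2^[2+k]≤2^[8*[1+k]] k))) (sparsify g h b μ hitting)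

  support-bounds : ∀ (k : ℕ) (g : Fn k) (δ : ℚ) (h : ℕ) → δ < 1ℚ → 1 ≤ℕ h →
    (μ₀ μ₁ : Dist k) → HittingMonoDist g false δ h μ₀ → HittingMonoDist g true δ h μ₁ →
    (2 ^ h ≤ℕ supportSize μ₀) × (2 ^ h ≤ℕ supportSize μ₁)
  support-bounds k g δ h δ<1 _ μ₀ μ₁ (_ , mono₀ , hit₀) (_ , mono₁ , hit₁) =
    support-lower-bound g {h = h} δ<1 false mono₀ hit₀ mono₁ hit₁ , support-lower-bound g {h = h} δ<1 true mono₁ hit₁ mono₀ hit₀
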